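{- For any positive integers $n,k_1,\ldots,k_n$, $$S_t(z_{k_1}z_{k_2}\cdots z_{k_n})=\sum_{i=1}^nt^{i-1}z_{k_1+\cdots+k_i}S_t(z_{k_{i+1}}\cdots z_{k_n}).$$ In particular, for any positive integers $k,n$, $S_t(z_k^n)=\sum_{i=1}^nt^{i-1}z_{ik}S_t(z_k^{n-i})$.
   Context: Let $\mathfrak{h}_t=\mathbb{Q}[t]\langle x,y\rangle$ ($t$ a variable) be the noncommutative polynomial algebra in letters $x,y$, $z_k=x^{k-1}y$; $z_k^m$ is a concatenation power and an empty product of $z$'s is the empty word $1$. $\sigma_t$ is the concatenation algebra automorphism with $\sigma_t(x)=x$, $\sigma_t(y)=tx+y$, and $S_t$ is the $\mathbb{Q}[t]$-linear map with $S_t(1)=1$, $S_t(wa)=\sigma_t(w)a$ for words $w$ and letters $a$. -}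

module Defs where

open import Data.Nat as ℕ using (ℕ; zero; suc; _∸_)
open import Data.Rational as ℚ using (ℚ; 0ℚ; 1ℚ)
open import Data.List using (List; []; _∷_; _++_; map; concatMap; replicate; reverse; take; drop; length; upTo; foldr)
open import Data.Product using (_×_; _,_)
open import Relation.Binary.PropositionalEquality using (_≡_)
open import Relation.Nullary using (Dec; yes; no)
open import Relation.Nullary.Decidable using (⌊_⌋)
open import Data.Bool using (Bool; true; false; _∧_; if_then_else_)

data Letter : Set where
  x y : Letter

Word : Set
Word = List Letter

_≟L_ : Letter → Letter → Bool
x ≟L x = true
y ≟L y = true
_ ≟L _ = false

_≟W_ : Word → Word → Bool
[] ≟W [] = true
(a ∷ u) ≟W (b ∷ v) = (a ≟L b) ∧ (u ≟W v)
_ ≟W _ = false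

-- An element of h_t = ℚ[t]⟨x,y⟩ is represented by a finite formal sum
-- of terms  q · t^e · w  (q ∈ ℚ, e ∈ ℕ, w a word).
Term : Set
Term = ℚ × ℕ × Word

H : Set
H = List Term

coeff : H → ℕ → Word → ℚ
coeff [] e w = 0ℚ
coeff ((q , f , v) ∷ p) e w =
  (if ⌊ f ℕ.≟ e ⌋ ∧ (v ≟W w) then q else 0ℚ) ℚ.+ coeff p e w

infix 4 _≈_
_≈_ : H → H → Set
p ≈ q = ∀ e w → coeff p e w ≡ coeff q e w

infixl 6 _⊕_
_⊕_ : H → H → H
_⊕_ = _++_

infixl 7 _⊗_
_⊗_ : H → H → H
p ⊗ q = concatMap (λ { (a , e , u) → map (λ { (b , f , v) → (a ℚ.* b , e ℕ.+ f , u ++ v) }) q }) p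

tpow : ℕ → H → H
tpow i = map (λ { (a , e , u) → (a , i ℕ.+ e , u) })

wordH : Word → H
wordH w = (1ℚ , 0 , w) ∷ []

one : H
one = wordH []

σL : Letter → H
σL x = wordH (x ∷ [])
σL y = (1ℚ , 1 , x ∷ []) ∷ (1ℚ , 0 , y ∷ []) ∷ []

σW : Word → H
σW [] = one
σW (a ∷ w) = σL a ⊗ σW w

-- S_t on words: S_t(1) = 1, S_t(w a) = σ_t(w) a
SWrev : List Letter → H
SWrev [] = one
SWrev (a ∷ r) = σW (reverse r) ⊗ wordH (a ∷ [])

SW : Word → H
SW w = SWrev (reverse w)

S : H → H
S = concatMap (λ { (q , e , w) → map (λ { (c , f , v) → (q ℚ.* c , e ℕ.+ f , v) }) (SW w) })

-- z_k = x^{k-1} y  (used for k ≥ 1)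
z : ℕ → Word
z k = replicate (k ∸ 1) x ++ (y ∷ [])

zs : List ℕ → Word
zs = concatMap z

Σ1 : ℕ → (ℕ → H) → H
Σ1 zero f = []
Σ1 (suc n) f = Σ1 n f ⊕ f (suc n)

{-# OPTIONS --safe #-}
-- The whole argument rests on S_t(u v) = σ_t(u) S_t(v) for nonempty v, on
-- σ_t(z_k) = x^(k-1) (t x + y) = t x^k + z_k, and on x^m z_k = z_(m+k) (σ_t fixes x).
-- Together they give the recurrence
--   S_t(z_k₁ z_k₂ w) = z_k₁ S_t(z_k₂ w) + t S_t(z_(k₁+k₂) w),
-- and induction on the number of letters z unfolds it into the stated sum;
-- the second formula is the case k₁ = ⋯ = k_n = k.
module Submission where

open import Defs
open import Data.Bool using (if_then_else_; _∧_)
open import Data.Empty using (⊥-elim)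
open import Data.List
  using (List; []; _∷_; _++_; _∷ʳ_; map; concatMap; length; take; drop; replicate; reverse; initLast; _∷ʳ′_)
open import Data.List.Properties
  using (++-assoc; ++-identityʳ; map-++; map-cong; map-∘; map-id; concatMap-++; concatMap-map; map-concatMap; concatMap-cong;
         length-replicate; reverse-++; reverse-involutive)
open import Data.List.Relation.Unary.All using (All; []; _∷_)
open import Data.List.Relation.Unary.All.Properties using (replicate⁺)
open import Data.Nat using (ℕ; zero; suc; _+_; _∸_; _*_; _⊓_; _≤_; _≟_; s≤s; z≤n)
open import Data.Nat.ListAction using (sum)
open import Data.Nat.Properties using (+-assoc; +-identityʳ; +-suc; m≤n⇒m⊓n≡m; m≤n⇒m≤n+o; m≤n⇒m≤1+n; ≤-refl)
open import Data.Product using (_×_; _,_)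
import Data.Rational as ℚ
import Data.Rational.Properties as ℚ
open import Level using (0ℓ)
open import Relation.Binary.Bundles using (Setoid)
open import Relation.Binary.PropositionalEquality
  using (_≡_; _≢_; refl; sym; trans; cong; cong₂; module ≡-Reasoning)
open import Relation.Nullary.Decidable using (⌊_⌋; isYes≗does)

infixl 7 _·_
_·_ : Term → Term → Term
(a , e , u) · (b , f , v) = a ℚ.* b , e + f , u ++ v

unit : Term
unit = ℚ.1ℚ , 0 , []

·-identityˡ : ∀ s → unit · s ≡ s
·-identityˡ (b , f , v) = cong (λ c → c , f , v) (ℚ.*-identityˡ b)

·-identityʳ : ∀ s → s · unit ≡ s
·-identityʳ (a , e , u) = cong₂ (λ c (fw : ℕ × Word) → c , fw)
  (ℚ.*-identityʳ a) (cong₂ _,_ (+-identityʳ e) (++-identityʳ u))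

·-assoc : ∀ s t r → (s · t) · r ≡ s · (t · r)
·-assoc (a , e , u) (b , f , v) (c , g , w) = cong₂ (λ q (fw : ℕ × Word) → q , fw)
  (ℚ.*-assoc a b c) (cong₂ _,_ (+-assoc e f g) (++-assoc u v w))

-- Definitionally, p ⊗ q is concatMap (λ s → map (s ·_) q) p and S (wordH w) is one ⊗ SW w.
⊗-identityˡ : ∀ p → one ⊗ p ≡ p
⊗-identityˡ p = trans (++-identityʳ _) (trans (map-cong ·-identityˡ p) (map-id p))

⊗-identityʳ : ∀ p → p ⊗ one ≡ p
⊗-identityʳ []      = refl
⊗-identityʳ (s ∷ p) = cong₂ _∷_ (·-identityʳ s) (⊗-identityʳ p)

⊗-distribʳ-⊕ : ∀ p q r → (p ⊕ q) ⊗ r ≡ p ⊗ r ⊕ q ⊗ r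
⊗-distribʳ-⊕ p q r = concatMap-++ _ p q

map-·-⊗ : ∀ s q r → map (s ·_) q ⊗ r ≡ map (s ·_) (q ⊗ r)
map-·-⊗ s q r = begin
  map (s ·_) q ⊗ r                                 ≡⟨ concatMap-map _ (s ·_) q ⟩
  concatMap (λ t → map ((s · t) ·_) r) q          ≡⟨ concatMap-cong (λ t → trans (map-cong (λ u → ·-assoc s t u) r) (map-∘ r)) q ⟩
  concatMap (λ t → map (s ·_) (map (t ·_) r)) q   ≡⟨ map-concatMap (s ·_) _ q ⟨
  map (s ·_) (q ⊗ r)                               ∎
  where open ≡-Reasoning

⊗-assoc : ∀ p q r → (p ⊗ q) ⊗ r ≡ p ⊗ (q ⊗ r)
⊗-assoc []      q r = refl
⊗-assoc (s ∷ p) q r = begin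
  (map (s ·_) q ++ p ⊗ q) ⊗ r        ≡⟨ ⊗-distribʳ-⊕ (map (s ·_) q) (p ⊗ q) r ⟩
  map (s ·_) q ⊗ r ++ (p ⊗ q) ⊗ r    ≡⟨ cong₂ _++_ (map-·-⊗ s q r) (⊗-assoc p q r) ⟩
  map (s ·_) (q ⊗ r) ++ p ⊗ (q ⊗ r)  ∎
  where open ≡-Reasoning

wordH-⊗ : ∀ u v → wordH u ⊗ wordH v ≡ wordH (u ++ v)
wordH-⊗ u v = cong (λ c → (c , 0 , u ++ v) ∷ []) (ℚ.*-identityˡ ℚ.1ℚ)

tpow-⊗ : ∀ i p q → tpow i p ⊗ q ≡ tpow i (p ⊗ q)
tpow-⊗ i []      q = refl
tpow-⊗ i (s ∷ p) q = begin
  map (shift i s ·_) q ++ tpow i p ⊗ q      ≡⟨ cong₂ _++_ (trans (map-cong (shift-· s) q) (map-∘ q)) (tpow-⊗ i p q) ⟩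
  tpow i (map (s ·_) q) ++ tpow i (p ⊗ q)   ≡⟨ map-++ _ (map (s ·_) q) (p ⊗ q) ⟨
  tpow i (map (s ·_) q ++ p ⊗ q)             ∎
  where
  open ≡-Reasoning
  shift : ℕ → Term → Term
  shift i (a , e , u) = a , i + e , u
  shift-· : ∀ s t → shift i s · t ≡ shift i (s · t)
  shift-· (a , e , u) (b , f , v) = cong (λ g → a ℚ.* b , g , u ++ v) (+-assoc i e f)

σW-++ : ∀ u v → σW (u ++ v) ≡ σW u ⊗ σW v
σW-++ []      v = sym (⊗-identityˡ (σW v))
σW-++ (a ∷ u) v = trans (cong (σL a ⊗_) (σW-++ u v)) (sym (⊗-assoc (σL a) (σW u) (σW v)))

σW-replicate-x : ∀ n → σW (replicate n x) ≡ wordH (replicate n x)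
σW-replicate-x zero    = refl
σW-replicate-x (suc n) = trans (cong (σL x ⊗_) (σW-replicate-x n)) (wordH-⊗ (x ∷ []) (replicate n x))

wordH-⊗-σy : ∀ u → wordH u ⊗ σL y ≡ tpow 1 (wordH (u ∷ʳ x)) ⊕ wordH (u ∷ʳ y)
wordH-⊗-σy u = cong (λ c → (c , 1 , u ∷ʳ x) ∷ (c , 0 , u ∷ʳ y) ∷ []) (ℚ.*-identityˡ ℚ.1ℚ)

replicate-∷ʳ : ∀ {A : Set} n (a : A) → replicate n a ∷ʳ a ≡ replicate (suc n) a
replicate-∷ʳ zero    a = refl
replicate-∷ʳ (suc n) a = cong (a ∷_) (replicate-∷ʳ n a)

replicate-+ : ∀ {A : Set} m n (a : A) → replicate (m + n) a ≡ replicate m a ++ replicate n a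
replicate-+ zero    n a = refl
replicate-+ (suc m) n a = cong (a ∷_) (replicate-+ m n a)

σW-z : ∀ {k} → 1 ≤ k → σW (z k) ≡ tpow 1 (wordH (replicate k x)) ⊕ wordH (z k)
σW-z {suc k} _ = begin
  σW (replicate k x ++ y ∷ [])                         ≡⟨ σW-++ (replicate k x) (y ∷ []) ⟩
  σW (replicate k x) ⊗ (σL y ⊗ one)                    ≡⟨ cong₂ _⊗_ (σW-replicate-x k) (⊗-identityʳ (σL y)) ⟩
  wordH (replicate k x) ⊗ σL y                         ≡⟨ wordH-⊗-σy (replicate k x) ⟩
  tpow 1 (wordH (replicate k x ∷ʳ x)) ⊕ wordH (z (suc k))
      ≡⟨ cong (λ w → tpow 1 (wordH w) ⊕ wordH (z (suc k))) (replicate-∷ʳ k x) ⟩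
  tpow 1 (wordH (replicate (suc k) x)) ⊕ wordH (z (suc k)) ∎
  where open ≡-Reasoning

replicate-x-++-z : ∀ m {k} → 1 ≤ k → replicate m x ++ z k ≡ z (m + k)
replicate-x-++-z m {suc k} _ = begin
  replicate m x ++ replicate k x ++ y ∷ []   ≡⟨ ++-assoc (replicate m x) (replicate k x) (y ∷ []) ⟨
  (replicate m x ++ replicate k x) ++ y ∷ [] ≡⟨ cong (_++ y ∷ []) (replicate-+ m k x) ⟨
  replicate (m + k) x ++ y ∷ []              ≡⟨ cong (λ n → replicate (n ∸ 1) x ++ y ∷ []) (+-suc m k) ⟨
  z (m + suc k)                              ∎
  where open ≡-Reasoning

S-∷ʳ : ∀ w a → S (wordH (w ∷ʳ a)) ≡ σW w ⊗ wordH (a ∷ [])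
S-∷ʳ w a = begin
  one ⊗ SWrev (reverse (w ∷ʳ a))        ≡⟨ ⊗-identityˡ _ ⟩
  SWrev (reverse (w ∷ʳ a))              ≡⟨ cong SWrev (reverse-++ w (a ∷ [])) ⟩
  σW (reverse (reverse w)) ⊗ wordH (a ∷ []) ≡⟨ cong (λ v → σW v ⊗ wordH (a ∷ [])) (reverse-involutive w) ⟩
  σW w ⊗ wordH (a ∷ [])                 ∎
  where open ≡-Reasoning

S-++ : ∀ u v → v ≢ [] → S (wordH (u ++ v)) ≡ σW u ⊗ S (wordH v)
S-++ u v v≢[] with initLast v
... | []       = ⊥-elim (v≢[] refl)
... | v ∷ʳ′ a  = begin
  S (wordH (u ++ v ∷ʳ a))             ≡⟨ cong (λ w → S (wordH w)) (++-assoc u v (a ∷ [])) ⟨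
  S (wordH ((u ++ v) ∷ʳ a))           ≡⟨ S-∷ʳ (u ++ v) a ⟩
  σW (u ++ v) ⊗ wordH (a ∷ [])        ≡⟨ cong (_⊗ wordH (a ∷ [])) (σW-++ u v) ⟩
  (σW u ⊗ σW v) ⊗ wordH (a ∷ [])      ≡⟨ ⊗-assoc (σW u) (σW v) (wordH (a ∷ [])) ⟩
  σW u ⊗ (σW v ⊗ wordH (a ∷ []))      ≡⟨ cong (σW u ⊗_) (S-∷ʳ v a) ⟨
  σW u ⊗ S (wordH (v ∷ʳ a))           ∎
  where open ≡-Reasoning

S-z : ∀ k → S (wordH (z k)) ≡ wordH (z k)
S-z k = begin
  S (wordH (replicate (k ∸ 1) x ∷ʳ y))             ≡⟨ S-∷ʳ (replicate (k ∸ 1) x) y ⟩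
  σW (replicate (k ∸ 1) x) ⊗ wordH (y ∷ [])        ≡⟨ cong (_⊗ wordH (y ∷ [])) (σW-replicate-x (k ∸ 1)) ⟩
  wordH (replicate (k ∸ 1) x) ⊗ wordH (y ∷ [])     ≡⟨ wordH-⊗ (replicate (k ∸ 1) x) (y ∷ []) ⟩
  wordH (z k)                                      ∎
  where open ≡-Reasoning

zs-∷-≢[] : ∀ k K → zs (k ∷ K) ≢ []
zs-∷-≢[] k K = ∷ʳ-++-≢[] (replicate (k ∸ 1) x) (zs K)
  where
  ∷ʳ-++-≢[] : ∀ u v → (u ∷ʳ y) ++ v ≢ []
  ∷ʳ-++-≢[] []      v ()
  ∷ʳ-++-≢[] (_ ∷ _) v ()

replicate-x-⊗-S-zs : ∀ m {k} K → 1 ≤ k → wordH (replicate m x) ⊗ S (wordH (zs (k ∷ K))) ≡ S (wordH (zs (m + k ∷ K)))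
replicate-x-⊗-S-zs m {k} K 1≤k = begin
  wordH (replicate m x) ⊗ S (wordH (zs (k ∷ K)))  ≡⟨ cong (_⊗ S (wordH (zs (k ∷ K)))) (σW-replicate-x m) ⟨
  σW (replicate m x) ⊗ S (wordH (zs (k ∷ K)))     ≡⟨ S-++ (replicate m x) (zs (k ∷ K)) (zs-∷-≢[] k K) ⟨
  S (wordH (replicate m x ++ z k ++ zs K))        ≡⟨ cong (λ w → S (wordH w)) (++-assoc (replicate m x) (z k) (zs K)) ⟨
  S (wordH ((replicate m x ++ z k) ++ zs K))      ≡⟨ cong (λ w → S (wordH (w ++ zs K))) (replicate-x-++-z m 1≤k) ⟩
  S (wordH (zs (m + k ∷ K)))                      ∎
  where open ≡-Reasoning

S-zs-recurrence : ∀ {k₁ k₂} K → 1 ≤ k₁ → 1 ≤ k₂ →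
  S (wordH (zs (k₁ ∷ k₂ ∷ K)))
    ≡ tpow 1 (S (wordH (zs (k₁ + k₂ ∷ K)))) ⊕ wordH (z k₁) ⊗ S (wordH (zs (k₂ ∷ K)))
S-zs-recurrence {k₁} {k₂} K 1≤k₁ 1≤k₂ = begin
  S (wordH (z k₁ ++ zs (k₂ ∷ K)))                          ≡⟨ S-++ (z k₁) (zs (k₂ ∷ K)) (zs-∷-≢[] k₂ K) ⟩
  σW (z k₁) ⊗ Sv                                           ≡⟨ cong (_⊗ Sv) (σW-z 1≤k₁) ⟩
  (tpow 1 (wordH xᵏ) ⊕ wordH (z k₁)) ⊗ Sv                  ≡⟨ ⊗-distribʳ-⊕ (tpow 1 (wordH xᵏ)) (wordH (z k₁)) Sv ⟩
  tpow 1 (wordH xᵏ) ⊗ Sv ⊕ wordH (z k₁) ⊗ Sv              ≡⟨ cong (_⊕ wordH (z k₁) ⊗ Sv) (tpow-⊗ 1 (wordH xᵏ) Sv) ⟩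
  tpow 1 (wordH xᵏ ⊗ Sv) ⊕ wordH (z k₁) ⊗ Sv              ≡⟨ cong (λ p → tpow 1 p ⊕ wordH (z k₁) ⊗ Sv) (replicate-x-⊗-S-zs k₁ K 1≤k₂) ⟩
  tpow 1 (S (wordH (zs (k₁ + k₂ ∷ K)))) ⊕ wordH (z k₁) ⊗ Sv ∎
  where
  open ≡-Reasoning
  xᵏ : Word
  xᵏ = replicate k₁ x
  Sv : H
  Sv = S (wordH (zs (k₂ ∷ K)))

≈-setoid : Setoid 0ℓ 0ℓ
≈-setoid = record
  { Carrier       = H
  ; _≈_           = _≈_
  ; isEquivalence = record
    { refl  = λ e w → refl
    ; sym   = λ p≈q e w → sym (p≈q e w)
    ; trans = λ p≈q q≈r e w → trans (p≈q e w) (q≈r e w)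
    }
  }

≡⇒≈ : ∀ {p q} → p ≡ q → p ≈ q
≡⇒≈ refl e w = refl

coeff-⊕ : ∀ p q e w → coeff (p ⊕ q) e w ≡ coeff p e w ℚ.+ coeff q e w
coeff-⊕ []                q e w = sym (ℚ.+-identityˡ (coeff q e w))
coeff-⊕ ((a , f , v) ∷ p) q e w =
  trans (cong (c ℚ.+_) (coeff-⊕ p q e w)) (sym (ℚ.+-assoc c (coeff p e w) (coeff q e w)))
  where
  c : ℚ.ℚ
  c = if ⌊ f ≟ e ⌋ ∧ (v ≟W w) then a else ℚ.0ℚ

⊕-congʳ : ∀ {p q} r → p ≈ q → p ⊕ r ≈ q ⊕ r
⊕-congʳ {p} {q} r p≈q e w =
  trans (coeff-⊕ p r e w) (trans (cong (ℚ._+ coeff r e w) (p≈q e w)) (sym (coeff-⊕ q r e w)))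

⊕-comm : ∀ p q → p ⊕ q ≈ q ⊕ p
⊕-comm p q e w =
  trans (coeff-⊕ p q e w) (trans (ℚ.+-comm (coeff p e w) (coeff q e w)) (sym (coeff-⊕ q p e w)))

tpow-zero : ∀ p → tpow 0 p ≡ p
tpow-zero []      = refl
tpow-zero (s ∷ p) = cong (s ∷_) (tpow-zero p)

coeff-tpow-suc-zero : ∀ i p w → coeff (tpow (suc i) p) 0 w ≡ ℚ.0ℚ
coeff-tpow-suc-zero i []      w = refl
coeff-tpow-suc-zero i (s ∷ p) w = cong (ℚ.0ℚ ℚ.+_) (coeff-tpow-suc-zero i p w)

coeff-tpow-suc-suc : ∀ i p e w → coeff (tpow (suc i) p) (suc e) w ≡ coeff (tpow i p) e w
coeff-tpow-suc-suc i []      e w = refl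
coeff-tpow-suc-suc i ((a , f , v) ∷ p) e w =
  cong₂ (λ b c → (if b ∧ (v ≟W w) then a else ℚ.0ℚ) ℚ.+ c) ⌊suc≟suc⌋ (coeff-tpow-suc-suc i p e w)
  where
  ⌊suc≟suc⌋ : ⌊ suc (i + f) ≟ suc e ⌋ ≡ ⌊ i + f ≟ e ⌋
  ⌊suc≟suc⌋ = trans (isYes≗does (suc (i + f) ≟ suc e)) (sym (isYes≗does (i + f ≟ e)))

tpow-cong : ∀ i {p q} → p ≈ q → tpow i p ≈ tpow i q
tpow-cong zero    {p} {q} p≈q e w = trans (cong (λ r → coeff r e w) (tpow-zero p))
                                     (trans (p≈q e w) (cong (λ r → coeff r e w) (sym (tpow-zero q))))
tpow-cong (suc i) {p} {q} p≈q zero    w = trans (coeff-tpow-suc-zero i p w) (sym (coeff-tpow-suc-zero i q w))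
tpow-cong (suc i) {p} {q} p≈q (suc e) w =
  trans (coeff-tpow-suc-suc i p e w) (trans (tpow-cong i {p} {q} p≈q e w) (sym (coeff-tpow-suc-suc i q e w)))

tpow-tpow : ∀ i j p → tpow i (tpow j p) ≡ tpow (i + j) p
tpow-tpow i j []               = refl
tpow-tpow i j ((a , e , u) ∷ p) = cong₂ _∷_ (cong (λ f → a , f , u) (sym (+-assoc i j e))) (tpow-tpow i j p)

tpow-Σ1 : ∀ i n f → tpow i (Σ1 n f) ≡ Σ1 n (λ j → tpow i (f j))
tpow-Σ1 i zero    f = refl
tpow-Σ1 i (suc n) f = trans (map-++ _ (Σ1 n f) (f (suc n))) (cong (_⊕ tpow i (f (suc n))) (tpow-Σ1 i n f))

Σ1-suc : ∀ n f → Σ1 (suc n) f ≡ f 1 ⊕ Σ1 n (λ i → f (suc i))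
Σ1-suc zero    f = sym (++-identityʳ (f 1))
Σ1-suc (suc n) f = trans (cong (_⊕ f (suc (suc n))) (Σ1-suc n f)) (++-assoc (f 1) (Σ1 n (λ i → f (suc i))) (f (suc (suc n))))

Σ1-cong : ∀ n {f g} → (∀ i → 1 ≤ i → i ≤ n → f i ≡ g i) → Σ1 n f ≡ Σ1 n g
Σ1-cong zero    f≡g = refl
Σ1-cong (suc n) f≡g = cong₂ _⊕_ (Σ1-cong n (λ i 1≤i i≤n → f≡g i 1≤i (m≤n⇒m≤1+n i≤n))) (f≡g (suc n) (s≤s z≤n) ≤-refl)

summand : List ℕ → ℕ → H
summand ks i = tpow (i ∸ 1) (wordH (z (sum (take i ks))) ⊗ S (wordH (zs (drop i ks))))

Σ1-summand-∷ : ∀ k₁ k₂ K →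
  Σ1 (length (k₁ ∷ k₂ ∷ K)) (summand (k₁ ∷ k₂ ∷ K))
    ≡ wordH (z k₁) ⊗ S (wordH (zs (k₂ ∷ K))) ⊕ tpow 1 (Σ1 (length (k₁ + k₂ ∷ K)) (summand (k₁ + k₂ ∷ K)))
Σ1-summand-∷ k₁ k₂ K = begin
  Σ1 (suc n) (summand (k₁ ∷ k₂ ∷ K))
    ≡⟨ Σ1-suc n (summand (k₁ ∷ k₂ ∷ K)) ⟩
  summand (k₁ ∷ k₂ ∷ K) 1 ⊕ Σ1 n (λ i → summand (k₁ ∷ k₂ ∷ K) (suc i))
    ≡⟨ cong₂ _⊕_ first (sym (trans (tpow-Σ1 1 n _) (Σ1-cong n shifted))) ⟩
  wordH (z k₁) ⊗ S (wordH (zs (k₂ ∷ K))) ⊕ tpow 1 (Σ1 n (summand (k₁ + k₂ ∷ K))) ∎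
  where
  open ≡-Reasoning
  n : ℕ
  n = length (k₂ ∷ K)
  first : summand (k₁ ∷ k₂ ∷ K) 1 ≡ wordH (z k₁) ⊗ S (wordH (zs (k₂ ∷ K)))
  first = trans (tpow-zero _) (cong (λ k → wordH (z k) ⊗ S (wordH (zs (k₂ ∷ K)))) (+-identityʳ k₁))
  shifted : ∀ i → 1 ≤ i → i ≤ n → tpow 1 (summand (k₁ + k₂ ∷ K) i) ≡ summand (k₁ ∷ k₂ ∷ K) (suc i)
  shifted (suc j) _ _ = trans (tpow-tpow 1 j _)
    (cong (λ k → tpow (suc j) (wordH (z k) ⊗ S (wordH (zs (drop j K))))) (+-assoc k₁ k₂ (sum (take j K))))

-- Coefficientwise equality does not determine the compared polynomials, so the
-- implicit arguments of the ≈-lemmas are given explicitly.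
S-zs-expansion : ∀ k K → All (1 ≤_) (k ∷ K) → S (wordH (zs (k ∷ K))) ≈ Σ1 (length (k ∷ K)) (summand (k ∷ K))
S-zs-expansion k [] (1≤k ∷ []) = ≡⇒≈ (begin
  S (wordH (z k ++ []))                  ≡⟨ cong (λ w → S (wordH w)) (++-identityʳ (z k)) ⟩
  S (wordH (z k))                        ≡⟨ S-z k ⟩
  wordH (z k)                            ≡⟨ ⊗-identityʳ (wordH (z k)) ⟨
  wordH (z k) ⊗ one                      ≡⟨ cong₂ (λ k′ p → wordH (z k′) ⊗ p) (+-identityʳ k) (⊗-identityˡ one) ⟨
  wordH (z (k + 0)) ⊗ S (wordH [])       ≡⟨ tpow-zero _ ⟨
  Σ1 1 (summand (k ∷ []))                ∎)
  where open ≡-Reasoning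
S-zs-expansion k₁ (k₂ ∷ K) (1≤k₁ ∷ 1≤k₂ ∷ 1≤K) = begin
  S (wordH (zs (k₁ ∷ k₂ ∷ K)))      ≡⟨ S-zs-recurrence K 1≤k₁ 1≤k₂ ⟩
  tpow 1 merged ⊕ head               ≈⟨ ⊕-congʳ {tpow 1 merged} {tpow 1 expansion} head (tpow-cong 1 {merged} {expansion} merged≈expansion) ⟩
  tpow 1 expansion ⊕ head            ≈⟨ ⊕-comm (tpow 1 expansion) head ⟩
  head ⊕ tpow 1 expansion            ≡⟨ Σ1-summand-∷ k₁ k₂ K ⟨
  Σ1 (length (k₁ ∷ k₂ ∷ K)) (summand (k₁ ∷ k₂ ∷ K)) ∎
  where
  open import Relation.Binary.Reasoning.Setoid ≈-setoid
  head merged expansion : H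
  head = wordH (z k₁) ⊗ S (wordH (zs (k₂ ∷ K)))
  merged = S (wordH (zs (k₁ + k₂ ∷ K)))
  expansion = Σ1 (length (k₁ + k₂ ∷ K)) (summand (k₁ + k₂ ∷ K))
  merged≈expansion : merged ≈ expansion
  merged≈expansion = S-zs-expansion (k₁ + k₂) K (m≤n⇒m≤n+o k₂ 1≤k₁ ∷ 1≤K)

take-replicate : ∀ {A : Set} i n (a : A) → take i (replicate n a) ≡ replicate (i ⊓ n) a
take-replicate zero    n       a = refl
take-replicate (suc i) zero    a = refl
take-replicate (suc i) (suc n) a = cong (a ∷_) (take-replicate i n a)

drop-replicate : ∀ {A : Set} i n (a : A) → drop i (replicate n a) ≡ replicate (n ∸ i) a
drop-replicate zero    n       a = refl
drop-replicate (suc i) zero    a = refl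
drop-replicate (suc i) (suc n) a = drop-replicate i n a

sum-replicate : ∀ n k → sum (replicate n k) ≡ n * k
sum-replicate zero    k = refl
sum-replicate (suc n) k = cong (k +_) (sum-replicate n k)

summand-replicate : ∀ n k i → i ≤ n →
  summand (replicate n k) i ≡ tpow (i ∸ 1) (wordH (z (i * k)) ⊗ S (wordH (zs (replicate (n ∸ i) k))))
summand-replicate n k i i≤n = cong₂ (λ m ks → tpow (i ∸ 1) (wordH (z m) ⊗ S (wordH (zs ks))))
  (trans (cong sum (trans (take-replicate i n k) (cong (λ j → replicate j k) (m≤n⇒m⊓n≡m i≤n)))) (sum-replicate i k))
  (drop-replicate i n k)

S-zs-replicate-expansion : ∀ k n → 1 ≤ k → 1 ≤ n →
  S (wordH (zs (replicate n k)))
    ≈ Σ1 n (λ i → tpow (i ∸ 1) (wordH (z (i * k)) ⊗ S (wordH (zs (replicate (n ∸ i) k)))))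
S-zs-replicate-expansion k (suc n) 1≤k _ = begin
  S (wordH (zs (replicate (suc n) k)))
    ≈⟨ S-zs-expansion k (replicate n k) (replicate⁺ (suc n) 1≤k) ⟩
  Σ1 (length (replicate (suc n) k)) (summand (replicate (suc n) k))
    ≡⟨ cong (λ m → Σ1 m (summand (replicate (suc n) k))) (length-replicate (suc n)) ⟩
  Σ1 (suc n) (summand (replicate (suc n) k))
    ≡⟨ Σ1-cong (suc n) (λ i _ i≤n → summand-replicate (suc n) k i i≤n) ⟩
  Σ1 (suc n) (λ i → tpow (i ∸ 1) (wordH (z (i * k)) ⊗ S (wordH (zs (replicate (suc n ∸ i) k))))) ∎
  where open import Relation.Binary.Reasoning.Setoid ≈-setoid

mainTheorem17 :
    ((ks : List ℕ) → 1 ≤ length ks → All (λ k → 1 ≤ k) ks →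
      S (wordH (zs ks))
        ≈ Σ1 (length ks) (λ i → tpow (i ∸ 1) (wordH (z (sum (take i ks))) ⊗ S (wordH (zs (drop i ks))))))
    × ((k n : ℕ) → 1 ≤ k → 1 ≤ n →
      S (wordH (zs (replicate n k)))
        ≈ Σ1 n (λ i → tpow (i ∸ 1) (wordH (z (i * k)) ⊗ S (wordH (zs (replicate (n ∸ i) k))))))
mainTheorem17 = (λ { [] () ; (k ∷ K) _ → S-zs-expansion k K }) , S-zs-replicate-expansion
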